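{- For every $M\in\mathcal{B}$ with entries $M=\pm\begin{pmatrix}a_M&b_M\\c_M&d_M\end{pmatrix}$ we have $|a_M|\le|c_M|$ and $|b_M|\le|d_M|$, and for every $\tilde M\in\tilde{\mathcal{B}}$ we have $|a_{\tilde M}|\le|c_{\tilde M}|$.
   Context: $S=\begin{pmatrix}0&-1\\1&0\end{pmatrix}$, $T=\begin{pmatrix}1&1\\0&1\end{pmatrix}$; $\bar S,A=[T^2],B=[ST^2S]$ are images in $\mathrm{PSL}_2(\mathbb{Z})$, and $A,B$ freely generate the image of $\Gamma(2)$. $\mathcal{B}$ is the set of elements $B^{f_1}A^{e_1}\cdots B^{f_m}A^{e_m}$ with $m\ge1$, integers $e_i,f_i$ all nonzero except possibly $e_m$; $\tilde{\mathcal{B}}=\{M\bar S:M\in\mathcal{B}\}\cup\{\bar S\}$. For $M\in\mathrm{PSL}_2(\mathbb{Z})$, $a_M,b_M,c_M,d_M$ denote the entries of a representative matrix (defined up to a common sign). -}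

module Defs where

open import Data.Integer using (ℤ; +_; -[1+_]; _+_; _*_; -_; ∣_∣)
open import Data.Nat using (ℕ; zero; suc)
open import Data.List using (List; []; _∷_)
open import Data.Product using (_×_; _,_; ∃)
open import Data.Sum using (_⊎_)
open import Data.Empty using (⊥)
open import Data.Unit using (⊤)
open import Relation.Binary.PropositionalEquality using (_≡_)
open import Relation.Nullary using (¬_)

record Mat2 : Set where
  constructor mat
  field
    a b c d : ℤ
open Mat2 public

_·_ : Mat2 → Mat2 → Mat2
mat a₁ b₁ c₁ d₁ · mat a₂ b₂ c₂ d₂ =
  mat (a₁ * a₂ + b₁ * c₂) (a₁ * b₂ + b₁ * d₂)
      (c₁ * a₂ + d₁ * c₂) (c₁ * b₂ + d₁ * d₂)
infixl 7 _·_

I₂ : Mat2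
I₂ = mat (+ 1) (+ 0) (+ 0) (+ 1)

-- inverse of a determinant-one matrix
inv : Mat2 → Mat2
inv (mat a b c d) = mat d (- b) (- c) a

S T : Mat2
S = mat (+ 0) (- (+ 1)) (+ 1) (+ 0)
T = mat (+ 1) (+ 1) (+ 0) (+ 1)

_^ℕ_ : Mat2 → ℕ → Mat2
M ^ℕ zero = I₂
M ^ℕ suc n = M · (M ^ℕ n)

_^ℤ_ : Mat2 → ℤ → Mat2
M ^ℤ (+ n) = M ^ℕ n
M ^ℤ -[1+ n ] = inv M ^ℕ suc n

-- matrix representatives (in SL₂(ℤ)) of A = [T²], B = [S T² S]
Aₘ Bₘ : Mat2
Aₘ = T · T
Bₘ = S · T · T · S

wordMat : List (ℤ × ℤ) → Mat2
wordMat [] = I₂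
wordMat ((f , e) ∷ ps) = (Bₘ ^ℤ f) · (Aₘ ^ℤ e) · wordMat ps

Admissible : List (ℤ × ℤ) → Set
Admissible [] = ⊥
Admissible ((f , e) ∷ []) = ¬ f ≡ + 0
Admissible ((f , e) ∷ p ∷ ps) = (¬ f ≡ + 0) × (¬ e ≡ + 0) × Admissible (p ∷ ps)

-- M ∈ 𝓑  (as a matrix representative; entries are defined up to common sign,
-- which does not affect absolute values)
InB : Mat2 → Set
InB M = ∃ λ ws → Admissible ws × M ≡ wordMat ws

InB̃ : Mat2 → Set
InB̃ M = (∃ λ N → InB N × M ≡ N · S) ⊎ (M ≡ S)

{-# OPTIONS --safe #-}
-- A = T² and B = ST²S are, up to sign, the shears (1 2; 0 1) and (1 0; −2 1), so B^f A^e acts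
-- on a column (x, y) by x ↦ x + 2e·y followed by y ↦ y − 2f·x. For |k| ≥ 2, adding k times
-- the larger entry to the smaller one makes the result at least as large as the old larger
-- entry. Hence along a word read from the right the dominant entry of each column swaps from
-- bottom to top under A^e and back under B^f; the innermost factor B^f A^e already has a
-- dominant bottom row. Right multiplication by S moves the second column into the first.
module Submission where

open import Defs
open import Data.Integer using (∣_∣)
open import Data.Nat using (_≤_)
open import Data.Product using (_×_)

open import Data.Integer using (ℤ; +_; -[1+_]; _+_; _*_; -_; _-_; _≟_)
open import Data.Integer.Properties using (abs-*; ∣-i∣≡∣i∣; ∣i-j∣≤∣i∣+∣j∣; ∣i∣≡0⇒i≡0; *-zeroˡ)
open import Data.Integer.Tactic.RingSolver using (solve-∀)
import Data.Nat as ℕ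
open import Data.Nat using (zero; suc; z≤n)
import Data.Nat.Properties as ℕP
open import Data.Nat.Properties using (+-cancelʳ-≤; +-monoʳ-≤; *-monoˡ-≤; n≢0⇒n>0; module ≤-Reasoning)
open import Data.List using ([]; _∷_)
open import Data.Product using (_,_; proj₂)
open import Data.Sum using (_⊎_; inj₁; inj₂)
open import Relation.Binary.PropositionalEquality
  using (_≡_; _≢_; refl; sym; trans; cong; subst; subst₂; module ≡-Reasoning)
open import Relation.Nullary using (yes; no)

mat-cong : ∀ {a₁ b₁ c₁ d₁ a₂ b₂ c₂ d₂} →
           a₁ ≡ a₂ → b₁ ≡ b₂ → c₁ ≡ c₂ → d₁ ≡ d₂ → mat a₁ b₁ c₁ d₁ ≡ mat a₂ b₂ c₂ d₂
mat-cong refl refl refl refl = refl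

·-assoc : ∀ M N P → (M · N) · P ≡ M · (N · P)
·-assoc M N P =
  mat-cong (entry (a N) (b N) (c N) (d N) (a M) (b M) (a P) (c P))
           (entry (a N) (b N) (c N) (d N) (a M) (b M) (b P) (d P))
           (entry (a N) (b N) (c N) (d N) (c M) (d M) (a P) (c P))
           (entry (a N) (b N) (c N) (d N) (c M) (d M) (b P) (d P))
  where
  entry : ∀ r s t u p q x y → (p * r + q * t) * x + (p * s + q * u) * y
                            ≡ p * (r * x + s * y) + q * (t * x + u * y)
  entry = solve-∀

·-identityʳ : ∀ M → M · I₂ ≡ M
·-identityʳ M = mat-cong (entry (a M) (b M)) (entry′ (a M) (b M))
                         (entry (c M) (d M)) (entry′ (c M) (d M))
  where
  entry : ∀ p q → p * + 1 + q * + 0 ≡ p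
  entry = solve-∀
  entry′ : ∀ p q → p * + 0 + q * + 1 ≡ q
  entry′ = solve-∀

·-S : ∀ M → M · S ≡ mat (b M) (- a M) (d M) (- c M)
·-S M = mat-cong (first (a M) (b M)) (second (a M) (b M))
                 (first (c M) (d M)) (second (c M) (d M))
  where
  first : ∀ p q → p * + 0 + q * + 1 ≡ q
  first = solve-∀
  second : ∀ p q → p * (- + 1) + q * + 0 ≡ - p
  second = solve-∀

negate : Mat2 → Mat2
negate (mat a b c d) = mat (- a) (- b) (- c) (- d)

negate-involutive : ∀ M → negate (negate M) ≡ M
negate-involutive M = mat-cong (neg² (a M)) (neg² (b M)) (neg² (c M)) (neg² (d M))
  where
  neg² : ∀ x → - - x ≡ x
  neg² = solve-∀

negate-·ˡ : ∀ M N → negate M · N ≡ negate (M · N)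
negate-·ˡ M N = mat-cong (entry (a M) (b M) (a N) (c N)) (entry (a M) (b M) (b N) (d N))
                         (entry (c M) (d M) (a N) (c N)) (entry (c M) (d M) (b N) (d N))
  where
  entry : ∀ p q x y → (- p) * x + (- q) * y ≡ - (p * x + q * y)
  entry = solve-∀

negate-·ʳ : ∀ M N → M · negate N ≡ negate (M · N)
negate-·ʳ M N = mat-cong (entry (a M) (b M) (a N) (c N)) (entry (a M) (b M) (b N) (d N))
                         (entry (c M) (d M) (a N) (c N)) (entry (c M) (d M) (b N) (d N))
  where
  entry : ∀ p q x y → p * (- x) + q * (- y) ≡ - (p * x + q * y)
  entry = solve-∀

infix 4 _≈±_
_≈±_ : Mat2 → Mat2 → Set
M ≈± N = M ≡ N ⊎ M ≡ negate N

≈±-negateˡ : ∀ {M N} → M ≈± N → negate M ≈± N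
≈±-negateˡ (inj₁ refl)        = inj₂ refl
≈±-negateˡ {N = N} (inj₂ refl) = inj₁ (negate-involutive N)

≈±-·ˡ : ∀ W {M N} → M ≈± N → W · M ≈± W · N
≈±-·ˡ W (inj₁ refl)        = inj₁ refl
≈±-·ˡ W {N = N} (inj₂ refl) = inj₂ (negate-·ʳ W N)

≈±-·ʳ : ∀ W {M N} → M ≈± N → M · W ≈± N · W
≈±-·ʳ W (inj₁ refl)        = inj₁ refl
≈±-·ʳ W {N = N} (inj₂ refl) = inj₂ (negate-·ˡ N W)

negate-^ℕ : ∀ M n → negate M ^ℕ n ≈± M ^ℕ n
negate-^ℕ M zero    = inj₁ refl
negate-^ℕ M (suc n) = subst (_≈± M ^ℕ suc n) (sym (negate-·ˡ M (negate M ^ℕ n)))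
                            (≈±-negateˡ (≈±-·ˡ M (negate-^ℕ M n)))

negate-^ℤ : ∀ M z → negate M ^ℤ z ≈± M ^ℤ z
negate-^ℤ M (+ n)    = negate-^ℕ M n
-- inv (negate M) and negate (inv M) coincide definitionally.
negate-^ℤ M -[1+ n ] = negate-^ℕ (inv M) (suc n)

upper lower : ℤ → Mat2
upper k = mat (+ 1) k (+ 0) (+ 1)
lower k = mat (+ 1) (+ 0) k (+ 1)

module OneParameterSubgroup
  (U : ℤ → Mat2)
  (U-0 : U (+ 0) ≡ I₂)
  (U-+ : ∀ k l → U k · U l ≡ U (k + l))
  (U-inv : ∀ k → inv (U k) ≡ U (- k))
  where

  U-^ℕ : ∀ k n → U k ^ℕ n ≡ U (+ n * k)
  U-^ℕ k zero    = sym (trans (cong U (*-zeroˡ k)) U-0)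
  U-^ℕ k (suc n) = begin
    U k · U k ^ℕ n     ≡⟨ cong (U k ·_) (U-^ℕ k n) ⟩
    U k · U (+ n * k)  ≡⟨ U-+ k (+ n * k) ⟩
    U (k + + n * k)    ≡⟨ cong U (unfold (+ n) k) ⟩
    U (+ suc n * k)    ∎
    where
    open ≡-Reasoning
    unfold : ∀ m k → k + m * k ≡ (+ 1 + m) * k
    unfold = solve-∀

  U-^ℤ : ∀ k z → U k ^ℤ z ≡ U (z * k)
  U-^ℤ k (+ n)    = U-^ℕ k n
  U-^ℤ k -[1+ n ] = begin
    inv (U k) ^ℕ suc n   ≡⟨ cong (_^ℕ suc n) (U-inv k) ⟩
    U (- k) ^ℕ suc n     ≡⟨ U-^ℕ (- k) (suc n) ⟩
    U (+ suc n * - k)    ≡⟨ cong U (negate-factor (+ suc n) k) ⟩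
    U (- + suc n * k)    ∎
    where
    open ≡-Reasoning
    negate-factor : ∀ m k → m * - k ≡ - m * k
    negate-factor = solve-∀

upper-+ : ∀ k l → upper k · upper l ≡ upper (k + l)
upper-+ k l = mat-cong (entry k) (sum k l) refl refl
  where
  entry : ∀ k → + 1 * + 1 + k * + 0 ≡ + 1
  entry = solve-∀
  sum : ∀ k l → + 1 * l + k * + 1 ≡ k + l
  sum = solve-∀

lower-+ : ∀ k l → lower k · lower l ≡ lower (k + l)
lower-+ k l = mat-cong refl refl (sum k l) (entry k)
  where
  sum : ∀ k l → k * + 1 + + 1 * l ≡ k + l
  sum = solve-∀
  entry : ∀ k → k * + 0 + + 1 * + 1 ≡ + 1
  entry = solve-∀

open OneParameterSubgroup upper refl upper-+ (λ _ → refl)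
  renaming (U-^ℤ to upper-^ℤ)
open OneParameterSubgroup lower refl lower-+ (λ _ → refl)
  renaming (U-^ℤ to lower-^ℤ)

upper-· : ∀ k W → upper k · W ≡ mat (a W + k * c W) (b W + k * d W) (c W) (d W)
upper-· k W = mat-cong (top k (a W) (c W)) (top k (b W) (d W))
                       (bottom (a W) (c W)) (bottom (b W) (d W))
  where
  top : ∀ k x y → + 1 * x + k * y ≡ x + k * y
  top = solve-∀
  bottom : ∀ x y → + 0 * x + + 1 * y ≡ y
  bottom = solve-∀

lower-· : ∀ k W → lower k · W ≡ mat (a W) (b W) (c W + k * a W) (d W + k * b W)
lower-· k W = mat-cong (top (a W) (c W)) (top (b W) (d W))
                       (bottom k (a W) (c W)) (bottom k (b W) (d W))
  where
  top : ∀ x y → + 1 * x + + 0 * y ≡ x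
  top = solve-∀
  bottom : ∀ k x y → k * x + + 1 * y ≡ y + k * x
  bottom = solve-∀

i≢0⇒∣i∣>0 : ∀ {i} → i ≢ + 0 → 0 ℕ.< ∣ i ∣
i≢0⇒∣i∣>0 i≢0 = n≢0⇒n>0 (λ ∣i∣≡0 → i≢0 (∣i∣≡0⇒i≡0 ∣i∣≡0))

∣i∣≤∣j*i∣ : ∀ i {j} → j ≢ + 0 → ∣ i ∣ ≤ ∣ j * i ∣
∣i∣≤∣j*i∣ i {j} j≢0 = begin
  ∣ i ∣             ≡⟨ sym (ℕP.*-identityˡ ∣ i ∣) ⟩
  1 ℕ.* ∣ i ∣       ≤⟨ *-monoˡ-≤ (∣ i ∣) (i≢0⇒∣i∣>0 j≢0) ⟩
  ∣ j ∣ ℕ.* ∣ i ∣   ≡⟨ sym (abs-* j i) ⟩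
  ∣ j * i ∣         ∎
  where open ≤-Reasoning

shear-dominates : ∀ x y k → ∣ x ∣ ≤ ∣ y ∣ → 2 ≤ ∣ k ∣ → ∣ y ∣ ≤ ∣ x + k * y ∣
shear-dominates x y k x≤y 2≤k = +-cancelʳ-≤ _ _ _ (begin
  ∣ y ∣ ℕ.+ ∣ y ∣                ≡⟨ cong (∣ y ∣ ℕ.+_) (sym (ℕP.+-identityʳ ∣ y ∣)) ⟩
  2 ℕ.* ∣ y ∣                    ≤⟨ *-monoˡ-≤ (∣ y ∣) 2≤k ⟩
  ∣ k ∣ ℕ.* ∣ y ∣                ≡⟨ sym (abs-* k y) ⟩
  ∣ k * y ∣                      ≡⟨ cong ∣_∣ (difference x (k * y)) ⟩
  ∣ (x + k * y) - x ∣            ≤⟨ ∣i-j∣≤∣i∣+∣j∣ (x + k * y) x ⟩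
  ∣ x + k * y ∣ ℕ.+ ∣ x ∣        ≤⟨ +-monoʳ-≤ (∣ x + k * y ∣) x≤y ⟩
  ∣ x + k * y ∣ ℕ.+ ∣ y ∣        ∎)
  where
  open ≤-Reasoning
  difference : ∀ x z → z ≡ (x + z) - x
  difference = solve-∀

BottomDominant TopDominant : Mat2 → Set
BottomDominant M = ∣ a M ∣ ≤ ∣ c M ∣ × ∣ b M ∣ ≤ ∣ d M ∣
TopDominant M = ∣ c M ∣ ≤ ∣ a M ∣ × ∣ d M ∣ ≤ ∣ b M ∣

BottomDominant-≈± : ∀ {M N} → M ≈± N → BottomDominant N → BottomDominant M
BottomDominant-≈± (inj₁ refl) dom = dom
BottomDominant-≈± {N = N} (inj₂ refl) (a≤c , b≤d) =
  subst₂ _≤_ (sym (∣-i∣≡∣i∣ (a N))) (sym (∣-i∣≡∣i∣ (c N))) a≤c ,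
  subst₂ _≤_ (sym (∣-i∣≡∣i∣ (b N))) (sym (∣-i∣≡∣i∣ (d N))) b≤d

upper-TopDominant : ∀ k W → 2 ≤ ∣ k ∣ → BottomDominant W → TopDominant (upper k · W)
upper-TopDominant k W 2≤k (a≤c , b≤d) = subst TopDominant (sym (upper-· k W))
  (shear-dominates (a W) (c W) k a≤c 2≤k , shear-dominates (b W) (d W) k b≤d 2≤k)

lower-BottomDominant : ∀ l W → 2 ≤ ∣ l ∣ → TopDominant W → BottomDominant (lower l · W)
lower-BottomDominant l W 2≤l (c≤a , d≤b) = subst BottomDominant (sym (lower-· l W))
  (shear-dominates (c W) (a W) l c≤a 2≤l , shear-dominates (d W) (b W) l d≤b 2≤l)

lower-upper-BottomDominant : ∀ l k → 2 ≤ ∣ l ∣ → BottomDominant (lower l · upper k)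
lower-upper-BottomDominant l k 2≤l = subst BottomDominant (sym (lower-· l (upper k)))
  (shear-dominates (+ 0) (+ 1) l z≤n 2≤l , second-column)
  where
  second-column : ∣ k ∣ ≤ ∣ + 1 + l * k ∣
  second-column with k ≟ + 0
  ... | yes refl = z≤n
  ... | no k≢0   = shear-dominates (+ 1) k l (i≢0⇒∣i∣>0 k≢0) 2≤l

shears-≈± : ∀ f e W → Bₘ ^ℤ f · Aₘ ^ℤ e · W ≈± lower (f * - + 2) · upper (e * + 2) · W
shears-≈± f e W = ≈±-·ʳ W (subst₂ (λ L U → Bₘ ^ℤ f · Aₘ ^ℤ e ≈± L · U)
                                (lower-^ℤ (- + 2) f) (upper-^ℤ (+ 2) e)
                                (≈±-·ʳ (Aₘ ^ℤ e) (negate-^ℤ (lower (- + 2)) f)))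

wordMat-BottomDominant : ∀ ws → Admissible ws → BottomDominant (wordMat ws)
wordMat-BottomDominant ((f , e) ∷ []) f≢0 =
  BottomDominant-≈± (subst (wordMat ((f , e) ∷ []) ≈±_) (·-identityʳ (lower l · upper k))
                           (shears-≈± f e I₂))
                    (lower-upper-BottomDominant l k (∣i∣≤∣j*i∣ (- + 2) f≢0))
  where
  l k : ℤ
  l = f * - + 2
  k = e * + 2
wordMat-BottomDominant ((f , e) ∷ ws@(_ ∷ _)) (f≢0 , e≢0 , admissible) =
  BottomDominant-≈± (subst (wordMat ((f , e) ∷ ws) ≈±_) (·-assoc (lower l) (upper k) W)
                           (shears-≈± f e W))
                    (lower-BottomDominant l (upper k · W) (∣i∣≤∣j*i∣ (- + 2) f≢0)
                      (upper-TopDominant k W (∣i∣≤∣j*i∣ (+ 2) e≢0)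
                        (wordMat-BottomDominant ws admissible)))
  where
  l k : ℤ
  l = f * - + 2
  k = e * + 2
  W : Mat2
  W = wordMat ws

lemma5p3 : ((M : Mat2) → InB M → (∣ a M ∣ ≤ ∣ c M ∣) × (∣ b M ∣ ≤ ∣ d M ∣))
    × ((M : Mat2) → InB̃ M → ∣ a M ∣ ≤ ∣ c M ∣)
lemma5p3 = InB⇒BottomDominant , InB̃⇒first-column
  where
  InB⇒BottomDominant : (M : Mat2) → InB M → BottomDominant M
  InB⇒BottomDominant M (ws , admissible , refl) = wordMat-BottomDominant ws admissible

  InB̃⇒first-column : (M : Mat2) → InB̃ M → ∣ a M ∣ ≤ ∣ c M ∣
  InB̃⇒first-column M (inj₁ (N , N∈B , refl)) =
    subst (λ P → ∣ a P ∣ ≤ ∣ c P ∣) (sym (·-S N)) (proj₂ (InB⇒BottomDominant N N∈B))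
  InB̃⇒first-column M (inj₂ refl) = z≤n
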